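{- Define $a(1)=1$ and $a(n)=1+\sum_m a(m)$ for $n>1$, the sum over all proper divisors $m$ of $n$ (positive divisors $m<n$). For $k\ge 0$ let $p_1,\dots,p_k$ be distinct primes and $a_k=a(p_1p_2\cdots p_k)$ (so $a_0=a(1)=1$; $a_k$ does not depend on the choice of the distinct primes). Then the exponential generating function of the sequence $(a_k)_{k\ge0}$ is $$\sum_{k\ge 0} a_k\frac{x^k}{k!}=\frac{e^x}{2-e^x}.$$
   Context: $a(n)$ is called the number of recursive divisors of $n$. -}

module Defs where

open import Data.Nat using (ℕ; zero; suc; _∸_; _*_; _!; _<_; NonZero)
open import Data.Nat.Properties using (_!≢0)
open import Data.Nat.Divisibility using (_∣?_)
open import Data.List using (List; filter; map; upTo)
open import Data.Integer using (+_)
open import Data.Rational using (ℚ; _/_; 0ℚ; 1ℚ) renaming (_+_ to _+ℚ_; _*_ to _*ℚ_; _-_ to _-ℚ_)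

properDivisors : ℕ → List ℕ
properDivisors n = filter (_∣? n) (map suc (upTo (n ∸ 1)))

prodFirst : (ℕ → ℕ) → ℕ → ℕ
prodFirst p zero = 1
prodFirst p (suc k) = prodFirst p k * p k

Series : Set
Series = ℕ → ℚ

sumTo : (ℕ → ℚ) → ℕ → ℚ
sumTo f zero = f zero
sumTo f (suc n) = sumTo f n +ℚ f (suc n)

_⊛_ : Series → Series → Series
(f ⊛ g) n = sumTo (λ j → f j *ℚ g (n ∸ j)) n

_⊖_ : Series → Series → Series
(f ⊖ g) n = f n -ℚ g n

constS : ℚ → Series
constS c zero = c
constS c (suc _) = 0ℚ

invFact : ℕ → ℚ
invFact k = (+ 1) / (k !) where instance _ = k !≢0

expS : Series
expS = invFact

egf : (ℕ → ℕ) → Series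
egf b k = (+ b k) / (k !) where instance _ = k !≢0

module Submission where

-- The proper divisors of a product of distinct primes p₁⋯pₖ are the products of the proper
-- sublists of [p₁, …, pₖ]. So, by strong induction on k, a (p₁⋯pₖ) depends only on k, and
-- writing b k for it and counting proper sublists by length,
--   b (n+1) = 1 + Σ_{j ≤ n} C(n+1, j) b j.
-- In the product of Σ b k xᵏ/k! with 2 − eˣ the coefficient of x^(n+1) is therefore
--   (b (n+1) − Σ_{j ≤ n} C(n+1, j) b j) / (n+1)! = 1/(n+1)!,
-- and the constant coefficient is b 0 = 1, so the product is eˣ.

open import Defs
open import Function.Base using (_∘_)
open import Function.Bundles using (mk⇔)
open import Function.Definitions using (Injective)
open import Data.Empty using (⊥-elim)
open import Data.Nat using (ℕ; zero; suc; _+_; _*_; _∸_; _≤_; _<_; z≤n; s≤s; nonTrivial⇒n>1)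
open import Data.Nat.Properties
open import Data.Nat.Divisibility
open import Data.Nat.Coprimality using (Coprime; coprime-divisor)
open import Data.Nat.Combinatorics using (_C_; nCn≡1; k>n⇒nCk≡0; nCk+nC[k+1]≡[n+1]C[k+1])
open import Data.Nat.Induction using (<-rec)
open import Data.Nat.Primality
  using (Prime; prime⇒nonZero; prime⇒nonTrivial; prime⇒irreducible; productOfPrimes≢0; productOfPrimes≥1)
open import Data.Nat.Primality.Factorisation using (factorisationHasAllPrimeFactors)
open import Data.Nat.ListAction using (sum; product)
open import Data.Nat.ListAction.Properties using (sum-++; sum-↭)
open import Data.Nat.Tactic.RingSolver using (solve-∀)
open import Data.Integer using (+_)
open import Data.Rational using (_/_)
open import Data.Product using (∃; _×_; _,_)
open import Data.Sum as Sum using (_⊎_; inj₁; inj₂)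
open import Data.List using (List; []; _∷_; [_]; _++_; _∷ʳ_; map; length; upTo; applyDownFrom)
open import Data.List.Properties using (map-++; map-∘; map-cong-local; ++-assoc; length-applyDownFrom)
open import Data.List.Membership.Propositional using (_∈_)
open import Data.List.Membership.Propositional.Properties
open import Data.List.Membership.Propositional.Properties.WithK using (unique∧set⇒bag)
open import Data.List.Relation.Unary.All as All using (All; []; _∷_)
import Data.List.Relation.Unary.All.Properties as All
open import Data.List.Relation.Unary.AllPairs using (AllPairs; []; _∷_)
open import Data.List.Relation.Unary.Any using (here)
open import Data.List.Relation.Unary.Unique.Propositional using (Unique)
import Data.List.Relation.Unary.Unique.Propositional.Properties as Unique
open import Data.List.Relation.Binary.Permutation.Propositional using (_↭_)
import Data.List.Relation.Binary.Permutation.Propositional.Properties as Perm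
open import Data.List.Relation.Binary.BagAndSetEquality using (∼bag⇒↭)
open import Relation.Nullary using (¬_; yes; no)
open import Relation.Binary.PropositionalEquality
  using (_≡_; refl; sym; trans; cong; cong₂; subst; module ≡-Reasoning)

sumToℕ : (ℕ → ℕ) → ℕ → ℕ
sumToℕ f zero = f zero
sumToℕ f (suc n) = sumToℕ f n + f (suc n)

sumToℕ-suc : ∀ f n → sumToℕ f (suc n) ≡ f 0 + sumToℕ (f ∘ suc) n
sumToℕ-suc f zero = refl
sumToℕ-suc f (suc n) = trans (cong (_+ f (2 + n)) (sumToℕ-suc f n)) (+-assoc (f 0) _ _)

sumToℕ-+ : ∀ f g n → sumToℕ (λ j → f j + g j) n ≡ sumToℕ f n + sumToℕ g n
sumToℕ-+ f g zero = refl
sumToℕ-+ f g (suc n) = trans (cong (_+ (f (suc n) + g (suc n))) (sumToℕ-+ f g n))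
  (interchange (sumToℕ f n) (sumToℕ g n) (f (suc n)) (g (suc n)))
  where
  interchange : ∀ w x y z → (w + x) + (y + z) ≡ (w + y) + (x + z)
  interchange = solve-∀

sumToℕ-cong : ∀ {f g} → (∀ j → f j ≡ g j) → ∀ n → sumToℕ f n ≡ sumToℕ g n
sumToℕ-cong f≗g zero = f≗g 0
sumToℕ-cong f≗g (suc n) = cong₂ _+_ (sumToℕ-cong f≗g n) (f≗g (suc n))

binomialTransform : (ℕ → ℕ) → ℕ → ℕ
binomialTransform g k = sumToℕ (λ j → (k C j) * g j) k

sumToℕ-C-suc : ∀ (g : ℕ → ℕ) k m →
  sumToℕ (λ j → (k C j) * g j) (suc m) ≡ g 0 + sumToℕ (λ j → (k C suc j) * g (suc j)) m
sumToℕ-C-suc g k m = trans (sumToℕ-suc (λ j → (k C j) * g j) m)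
  (cong (_+ sumToℕ (λ j → (k C suc j) * g (suc j)) m) (+-identityʳ (g 0)))

binomialTransform-unfold : ∀ g k →
  binomialTransform g k ≡ g 0 + sumToℕ (λ j → (k C suc j) * g (suc j)) k
binomialTransform-unfold g k = begin
  binomialTransform g k
    ≡⟨ +-identityʳ _ ⟨
  binomialTransform g k + 0 * g (suc k)
    ≡⟨ cong (λ c → binomialTransform g k + c * g (suc k)) (k>n⇒nCk≡0 (n<1+n k)) ⟨
  sumToℕ (λ j → (k C j) * g j) (suc k)
    ≡⟨ sumToℕ-C-suc g k k ⟩
  g 0 + sumToℕ (λ j → (k C suc j) * g (suc j)) k ∎
  where open ≡-Reasoning

binomialTransform-suc : ∀ g k →
  binomialTransform g (suc k) ≡ binomialTransform g k + binomialTransform (g ∘ suc) k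
binomialTransform-suc g k = begin
  binomialTransform g (suc k)
    ≡⟨ sumToℕ-C-suc g (suc k) k ⟩
  g 0 + sumToℕ (λ j → (suc k C suc j) * g (suc j)) k
    ≡⟨ cong (_+_ (g 0)) (sumToℕ-cong pascal k) ⟩
  g 0 + sumToℕ (λ j → (k C j) * g (suc j) + (k C suc j) * g (suc j)) k
    ≡⟨ cong (_+_ (g 0)) (sumToℕ-+ _ _ k) ⟩
  g 0 + (binomialTransform (g ∘ suc) k + X)
    ≡⟨ rearrange (g 0) _ X ⟩
  (g 0 + X) + binomialTransform (g ∘ suc) k
    ≡⟨ cong (_+ binomialTransform (g ∘ suc) k) (binomialTransform-unfold g k) ⟨
  binomialTransform g k + binomialTransform (g ∘ suc) k ∎
  where
  open ≡-Reasoning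
  X = sumToℕ (λ j → (k C suc j) * g (suc j)) k
  pascal : ∀ j → (suc k C suc j) * g (suc j) ≡ (k C j) * g (suc j) + (k C suc j) * g (suc j)
  pascal j = trans (cong (_* g (suc j)) (sym (nCk+nC[k+1]≡[n+1]C[k+1] k j)))
    (*-distribʳ-+ (g (suc j)) (k C j) (k C suc j))
  rearrange : ∀ a y x → a + (y + x) ≡ (a + x) + y
  rearrange = solve-∀

module _ {ℓ} {A : Set ℓ} where

  sublists : List A → List (List A)
  sublists [] = [ [] ]
  sublists (x ∷ xs) = sublists xs ++ map (x ∷_) (sublists xs)

  properSublists : List A → List (List A)
  properSublists [] = []
  properSublists (x ∷ xs) = sublists xs ++ map (x ∷_) (properSublists xs)

  sublists≡properSublists∷ʳ : ∀ xs → sublists xs ≡ properSublists xs ∷ʳ xs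
  sublists≡properSublists∷ʳ [] = refl
  sublists≡properSublists∷ʳ (x ∷ xs) = begin
    sublists xs ++ map (x ∷_) (sublists xs)
      ≡⟨ cong (λ ys → sublists xs ++ map (x ∷_) ys) (sublists≡properSublists∷ʳ xs) ⟩
    sublists xs ++ map (x ∷_) (properSublists xs ∷ʳ xs)
      ≡⟨ cong (sublists xs ++_) (map-++ (x ∷_) (properSublists xs) [ xs ]) ⟩
    sublists xs ++ (map (x ∷_) (properSublists xs) ∷ʳ (x ∷ xs))
      ≡⟨ ++-assoc (sublists xs) _ _ ⟨
    properSublists (x ∷ xs) ∷ʳ (x ∷ xs) ∎
    where open ≡-Reasoning

  ∈-sublists-∷⁻ : ∀ x xs {ys} → ys ∈ sublists (x ∷ xs) →
    ys ∈ sublists xs ⊎ ∃ λ zs → zs ∈ sublists xs × ys ≡ x ∷ zs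
  ∈-sublists-∷⁻ x xs = Sum.map₂ (∈-map⁻ _) ∘ ∈-++⁻ (sublists xs)

  ∈-properSublists⇒∈-sublists : ∀ xs {ys} → ys ∈ properSublists xs → ys ∈ sublists xs
  ∈-properSublists⇒∈-sublists xs ys∈ = subst (_ ∈_) (sym (sublists≡properSublists∷ʳ xs)) (∈-++⁺ˡ ys∈)

  All-sublists : ∀ {p} {P : A → Set p} {xs ys} → All P xs → ys ∈ sublists xs → All P ys
  All-sublists [] (here refl) = []
  All-sublists {xs = x ∷ xs} (px ∷ pxs) ys∈ with ∈-sublists-∷⁻ x xs ys∈
  ... | inj₁ ys∈′ = All-sublists pxs ys∈′
  ... | inj₂ (_ , zs∈ , refl) = px ∷ All-sublists pxs zs∈

  AllPairs-sublists : ∀ {r} {R : A → A → Set r} {xs ys} → AllPairs R xs → ys ∈ sublists xs → AllPairs R ys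
  AllPairs-sublists [] (here refl) = []
  AllPairs-sublists {xs = x ∷ xs} (rx ∷ rxs) ys∈ with ∈-sublists-∷⁻ x xs ys∈
  ... | inj₁ ys∈′ = AllPairs-sublists rxs ys∈′
  ... | inj₂ (_ , zs∈ , refl) = All-sublists rx zs∈ ∷ AllPairs-sublists rxs zs∈

  length-sublists : ∀ xs {ys} → ys ∈ sublists xs → length ys ≤ length xs
  length-sublists [] (here refl) = z≤n
  length-sublists (x ∷ xs) ys∈ with ∈-sublists-∷⁻ x xs ys∈
  ... | inj₁ ys∈′ = m≤n⇒m≤1+n (length-sublists xs ys∈′)
  ... | inj₂ (_ , zs∈ , refl) = s≤s (length-sublists xs zs∈)

  length-properSublists : ∀ xs {ys} → ys ∈ properSublists xs → length ys < length xs
  length-properSublists (x ∷ xs) ys∈ with ∈-++⁻ (sublists xs) ys∈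
  ... | inj₁ ys∈′ = s≤s (length-sublists xs ys∈′)
  ... | inj₂ ys∈′ with ∈-map⁻ (x ∷_) ys∈′
  ...   | _ , zs∈ , refl = s≤s (length-properSublists xs zs∈)

sum-map-++ : ∀ {ℓ} {B : Set ℓ} (f : B → ℕ) xs ys →
  sum (map f (xs ++ ys)) ≡ sum (map f xs) + sum (map f ys)
sum-map-++ f xs ys = trans (cong sum (map-++ f xs ys)) (sum-++ (map f xs) (map f ys))

module _ {ℓ} {A : Set ℓ} where

  sum-sublists : ∀ (g : ℕ → ℕ) (xs : List A) →
    sum (map (g ∘ length) (sublists xs)) ≡ binomialTransform g (length xs)
  sum-sublists g [] = refl
  sum-sublists g (x ∷ xs) = begin
    sum (map (g ∘ length) (sublists xs ++ map (x ∷_) (sublists xs)))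
      ≡⟨ sum-map-++ (g ∘ length) (sublists xs) _ ⟩
    sum (map (g ∘ length) (sublists xs)) + sum (map (g ∘ length) (map (x ∷_) (sublists xs)))
      ≡⟨ cong (λ ns → sum (map (g ∘ length) (sublists xs)) + sum ns) (map-∘ (sublists xs)) ⟨
    sum (map (g ∘ length) (sublists xs)) + sum (map ((g ∘ suc) ∘ length) (sublists xs))
      ≡⟨ cong₂ _+_ (sum-sublists g xs) (sum-sublists (g ∘ suc) xs) ⟩
    binomialTransform g (length xs) + binomialTransform (g ∘ suc) (length xs)
      ≡⟨ binomialTransform-suc g (length xs) ⟨
    binomialTransform g (length (x ∷ xs)) ∎
    where open ≡-Reasoning

  sum-properSublists : ∀ (g : ℕ → ℕ) (xs : List A) {n} → length xs ≡ suc n →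
    sum (map (g ∘ length) (properSublists xs)) ≡ sumToℕ (λ j → (suc n C j) * g j) n
  sum-properSublists g xs {n} |xs|≡1+n = +-cancelʳ-≡ (g (suc n) + 0) _ _ (begin
    sum (map (g ∘ length) (properSublists xs)) + (g (suc n) + 0)
      ≡⟨ cong (λ k → sum (map (g ∘ length) (properSublists xs)) + (g k + 0)) |xs|≡1+n ⟨
    sum (map (g ∘ length) (properSublists xs)) + sum (map (g ∘ length) [ xs ])
      ≡⟨ sum-map-++ (g ∘ length) (properSublists xs) [ xs ] ⟨
    sum (map (g ∘ length) (properSublists xs ∷ʳ xs))
      ≡⟨ cong (sum ∘ map (g ∘ length)) (sublists≡properSublists∷ʳ xs) ⟨
    sum (map (g ∘ length) (sublists xs))
      ≡⟨ sum-sublists g xs ⟩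
    binomialTransform g (length xs)
      ≡⟨ cong (binomialTransform g) |xs|≡1+n ⟩
    sumToℕ (λ j → (suc n C j) * g j) n + (suc n C suc n) * g (suc n)
      ≡⟨ cong (λ c → sumToℕ (λ j → (suc n C j) * g j) n + c * g (suc n)) (nCn≡1 (suc n)) ⟩
    sumToℕ (λ j → (suc n C j) * g j) n + (g (suc n) + 0) ∎)
    where open ≡-Reasoning

  sum-properSublists-length : ∀ (g : ℕ → ℕ) (xs ys : List A) → length xs ≡ length ys →
    sum (map (g ∘ length) (properSublists xs)) ≡ sum (map (g ∘ length) (properSublists ys))
  sum-properSublists-length g [] [] _ = refl
  sum-properSublists-length g (x ∷ xs) ys |x∷xs|≡|ys| =
    trans (sum-properSublists g (x ∷ xs) refl) (sym (sum-properSublists g ys (sym |x∷xs|≡|ys|)))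

Unique-++⁻ˡ : ∀ {ℓ} {A : Set ℓ} (xs : List A) {ys} → Unique (xs ++ ys) → Unique xs
Unique-++⁻ˡ [] _ = []
Unique-++⁻ˡ (x ∷ xs) (x∉ ∷ u) = All.++⁻ˡ xs x∉ ∷ Unique-++⁻ˡ xs u

DistinctPrimes : List ℕ → Set
DistinctPrimes ps = All Prime ps × Unique ps

DistinctPrimes-sublists : ∀ {xs ys} → DistinctPrimes xs → ys ∈ sublists xs → DistinctPrimes ys
DistinctPrimes-sublists (primes , unique) ys∈ = All-sublists primes ys∈ , AllPairs-sublists unique ys∈

prime>1 : ∀ {p} → Prime p → 1 < p
prime>1 {p} pp = nonTrivial⇒n>1 p {{prime⇒nonTrivial pp}}

product-sublists-∣ : ∀ xs {ys} → ys ∈ sublists xs → product ys ∣ product xs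
product-sublists-∣ [] (here refl) = ∣-refl
product-sublists-∣ (x ∷ xs) ys∈ with ∈-sublists-∷⁻ x xs ys∈
... | inj₁ ys∈′ = ∣-trans (product-sublists-∣ xs ys∈′) (n∣m*n x)
... | inj₂ (_ , zs∈ , refl) = *-monoʳ-∣ x (product-sublists-∣ xs zs∈)

product-properSublists-< : ∀ {xs ys} → All Prime xs → ys ∈ properSublists xs → product ys < product xs
product-properSublists-< {x ∷ xs} (px ∷ pxs) ys∈ with ∈-++⁻ (sublists xs) ys∈
... | inj₁ ys∈′ = ≤-<-trans (∣⇒≤ {{productOfPrimes≢0 pxs}} (product-sublists-∣ xs ys∈′))
  (subst (product xs <_) (*-comm (product xs) x) (m<m*n (product xs) x {{productOfPrimes≢0 pxs}} (prime>1 px)))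
... | inj₂ ys∈′ with ∈-map⁻ (x ∷_) ys∈′
...   | _ , zs∈ , refl = *-monoʳ-< x {{prime⇒nonZero px}} (product-properSublists-< pxs zs∈)

prime∤⇒coprime : ∀ {p d} → Prime p → ¬ p ∣ d → Coprime d p
prime∤⇒coprime pp p∤d (c∣d , c∣p) with prime⇒irreducible pp c∣p
... | inj₁ c≡1 = c≡1
... | inj₂ refl = ⊥-elim (p∤d c∣d)

∃-sublist-product≡divisor : ∀ {xs d} → All Prime xs → d ∣ product xs →
  ∃ λ ys → ys ∈ sublists xs × product ys ≡ d
∃-sublist-product≡divisor {[]} [] d∣1 = [] , here refl , sym (∣1⇒≡1 d∣1)
∃-sublist-product≡divisor {x ∷ xs} {d} (px ∷ pxs) d∣ with x ∣? d
... | no x∤d with ∃-sublist-product≡divisor pxs (coprime-divisor (prime∤⇒coprime px x∤d) d∣)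
...   | ys , ys∈ , refl = ys , ∈-++⁺ˡ ys∈ , refl
∃-sublist-product≡divisor {x ∷ xs} (px ∷ pxs) d∣ | yes (divides c refl)
  with ∃-sublist-product≡divisor pxs
         (*-cancelˡ-∣ x {{prime⇒nonZero px}} (subst (_∣ x * product xs) (*-comm c x) d∣))
... | ys , ys∈ , refl = x ∷ ys , ∈-++⁺ʳ (sublists xs) (∈-map⁺ (x ∷_) ys∈) , *-comm x (product ys)

Unique-map-product-sublists : ∀ {xs} → DistinctPrimes xs → Unique (map product (sublists xs))
Unique-map-product-sublists {[]} _ = [] ∷ []
Unique-map-product-sublists {x ∷ xs} (px ∷ pxs , x∉xs ∷ u) =
  subst Unique (sym products) (Unique.++⁺ U (Unique.map⁺ (*-cancelˡ-≡ _ _ x {{prime⇒nonZero px}}) U) disjoint)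
  where
  U = Unique-map-product-sublists (pxs , u)
  products : map product (sublists (x ∷ xs)) ≡ map product (sublists xs) ++ map (x *_) (map product (sublists xs))
  products = trans (map-++ product (sublists xs) _)
    (cong (map product (sublists xs) ++_) (trans (sym (map-∘ (sublists xs))) (map-∘ (sublists xs))))
  disjoint : ∀ {v} → ¬ (v ∈ map product (sublists xs) × v ∈ map (x *_) (map product (sublists xs)))
  disjoint (v∈ , xw∈) with ∈-map⁻ product v∈ | ∈-map⁻ (x *_) xw∈
  ... | ys , ys∈ , refl | w , _ , ys≡xw =
    All.lookup x∉xs (factorisationHasAllPrimeFactors px x∣ pxs) refl
    where
    x∣ : x ∣ product xs
    x∣ = ∣-trans (divides w (trans ys≡xw (*-comm x w))) (product-sublists-∣ xs ys∈)

Unique-map-product-properSublists : ∀ {xs} → DistinctPrimes xs → Unique (map product (properSublists xs))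
Unique-map-product-properSublists {xs} ps = Unique-++⁻ˡ (map product (properSublists xs))
  (subst Unique (trans (cong (map product) (sublists≡properSublists∷ʳ xs)) (map-++ product (properSublists xs) _))
    (Unique-map-product-sublists ps))

∈-properDivisors⁻ : ∀ {d n} → d ∈ properDivisors n → d ∣ n × d < n
∈-properDivisors⁻ {n = n} d∈ with ∈-filter⁻ (_∣? n) {xs = map suc (upTo (n ∸ 1))} d∈
... | d∈′ , d∣n with ∈-map⁻ suc d∈′
...   | i , i∈ , refl = d∣n , 1+i<n n (∈-upTo⁻ i∈)
  where
  1+i<n : ∀ n → i < n ∸ 1 → suc i < n
  1+i<n (suc n) i<n = s≤s i<n

∈-properDivisors⁺ : ∀ {d n} → d ∣ n → d < n → d ∈ properDivisors n
∈-properDivisors⁺ {zero} 0∣n 0<n = ⊥-elim (<-irrefl (sym (0∣⇒≡0 0∣n)) 0<n)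
∈-properDivisors⁺ {suc i} {suc n} d∣n (s≤s i<n) = ∈-filter⁺ (_∣? suc n) (∈-map⁺ suc (∈-upTo⁺ i<n)) d∣n

Unique-properDivisors : ∀ n → Unique (properDivisors n)
Unique-properDivisors n = Unique.filter⁺ (_∣? n) (Unique.map⁺ suc-injective (Unique.upTo⁺ (n ∸ 1)))

properDivisors-product : ∀ {xs} → DistinctPrimes xs →
  properDivisors (product xs) ↭ map product (properSublists xs)
properDivisors-product {xs} ps@(primes , _) = ∼bag⇒↭ (unique∧set⇒bag
  (Unique-properDivisors (product xs)) (Unique-map-product-properSublists ps) (mk⇔ to from))
  where
  to : ∀ {d} → d ∈ properDivisors (product xs) → d ∈ map product (properSublists xs)
  to d∈ with ∈-properDivisors⁻ d∈
  ... | d∣ , d< with ∃-sublist-product≡divisor primes d∣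
  ...   | ys , ys∈ , refl
    with ∈-++⁻ (properSublists xs) (subst (ys ∈_) (sublists≡properSublists∷ʳ xs) ys∈)
  ...     | inj₁ ys∈′ = ∈-map⁺ product ys∈′
  ...     | inj₂ (here refl) = ⊥-elim (<-irrefl refl d<)
  from : ∀ {d} → d ∈ map product (properSublists xs) → d ∈ properDivisors (product xs)
  from d∈ with ∈-map⁻ product d∈
  ... | ys , ys∈ , refl = ∈-properDivisors⁺
    (product-sublists-∣ xs (∈-properSublists⇒∈-sublists xs ys∈)) (product-properSublists-< primes ys∈)

module RecursiveDivisors (a : ℕ → ℕ) (a[1]≡1 : a 1 ≡ 1)
  (a-rec : ∀ n → 1 < n → a n ≡ 1 + sum (map a (properDivisors n))) where

  a-product : ∀ {xs} → DistinctPrimes xs →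
    a (product xs) ≡ 1 + sum (map (a ∘ product) (properSublists xs))
  a-product {[]} _ = a[1]≡1
  a-product {x ∷ xs} ps@(px ∷ pxs , _) = trans (a-rec _ (*-mono-≤ (prime>1 px) (productOfPrimes≥1 pxs)))
    (cong suc (trans (sum-↭ (Perm.map⁺ a (properDivisors-product ps)))
                     (cong sum (sym (map-∘ (properSublists (x ∷ xs)))))))

  module _ (p : ℕ → ℕ) (p-prime : ∀ i → Prime (p i)) (p-injective : Injective _≡_ _≡_ p) where

    firstPrimes : ℕ → List ℕ
    firstPrimes = applyDownFrom p

    firstPrimes-distinct : ∀ k → DistinctPrimes (firstPrimes k)
    firstPrimes-distinct k = All.applyDownFrom⁺₂ p k p-prime ,
      Unique.applyDownFrom⁺₁ p k (λ j<i _ → <⇒≢ j<i ∘ sym ∘ p-injective)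

    product-firstPrimes : ∀ k → product (firstPrimes k) ≡ prodFirst p k
    product-firstPrimes zero = refl
    product-firstPrimes (suc k) = trans (*-comm (p k) _) (cong (_* p k) (product-firstPrimes k))

    b : ℕ → ℕ
    b k = a (prodFirst p k)

    sum-a∘product≡sum-b∘length : ∀ xs →
      (∀ {ys} → ys ∈ properSublists xs → a (product ys) ≡ b (length ys)) →
      sum (map (a ∘ product) (properSublists xs)) ≡ sum (map (b ∘ length) (properSublists xs))
    sum-a∘product≡sum-b∘length xs eq = cong sum (map-cong-local (All.tabulate eq))

    a-product≡b-length : ∀ {xs} → DistinctPrimes xs → a (product xs) ≡ b (length xs)
    a-product≡b-length {xs} ps = <-rec P step (length xs) xs ps refl
      where
      P : ℕ → Set
      P k = ∀ xs → DistinctPrimes xs → length xs ≡ k → a (product xs) ≡ b k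
      step : ∀ k → (∀ {m} → m < k → P m) → P k
      step k ih xs ps |xs|≡k = begin
        a (product xs)
          ≡⟨ a-product ps ⟩
        1 + sum (map (a ∘ product) (properSublists xs))
          ≡⟨ cong suc (sum-a∘product≡sum-b∘length xs (ih′ xs ps |xs|≡k)) ⟩
        1 + sum (map (b ∘ length) (properSublists xs))
          ≡⟨ cong suc (sum-properSublists-length b xs L (trans |xs|≡k (sym |L|≡k))) ⟩
        1 + sum (map (b ∘ length) (properSublists L))
          ≡⟨ cong suc (sum-a∘product≡sum-b∘length L (ih′ L L-distinct |L|≡k)) ⟨
        1 + sum (map (a ∘ product) (properSublists L))
          ≡⟨ a-product L-distinct ⟨
        a (product L)
          ≡⟨ cong a (product-firstPrimes k) ⟩
        b k ∎
        where
        open ≡-Reasoning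
        L = firstPrimes k
        L-distinct = firstPrimes-distinct k
        |L|≡k = length-applyDownFrom p k
        ih′ : ∀ xs → DistinctPrimes xs → length xs ≡ k →
          ∀ {ys} → ys ∈ properSublists xs → a (product ys) ≡ b (length ys)
        ih′ xs ps refl ys∈ = ih (length-properSublists xs ys∈) _
          (DistinctPrimes-sublists ps (∈-properSublists⇒∈-sublists xs ys∈)) refl

    b-rec : ∀ n → b (suc n) ≡ 1 + sumToℕ (λ j → (suc n C j) * b j) n
    b-rec n = begin
      b (suc n)
        ≡⟨ cong a (product-firstPrimes (suc n)) ⟨
      a (product L)
        ≡⟨ a-product L-distinct ⟩
      1 + sum (map (a ∘ product) (properSublists L))
        ≡⟨ cong suc (sum-a∘product≡sum-b∘length L sublist-a≡b) ⟩
      1 + sum (map (b ∘ length) (properSublists L))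
        ≡⟨ cong suc (sum-properSublists b L (length-applyDownFrom p (suc n))) ⟩
      1 + sumToℕ (λ j → (suc n C j) * b j) n ∎
      where
      open ≡-Reasoning
      L = firstPrimes (suc n)
      L-distinct = firstPrimes-distinct (suc n)
      sublist-a≡b : ∀ {ys} → ys ∈ properSublists L → a (product ys) ≡ b (length ys)
      sublist-a≡b = a-product≡b-length ∘ DistinctPrimes-sublists L-distinct ∘ ∈-properSublists⇒∈-sublists L

module PowerSeries where

  open import Data.Nat using (_!; NonZero)
  open import Data.Nat.Combinatorics using (nCk≡n!/k![n-k]!; k![n∸k]!∣n!)
  open import Data.Nat.DivMod using (m/n*n≡m)
  open import Data.Integer as ℤ using ()
  import Data.Integer.Properties as ℤ
  open import Data.Rational as ℚ using (ℚ; 1ℚ; toℚᵘ)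
  import Data.Rational.Properties as ℚ
  open import Data.Rational.Solver using (module +-*-Solver)
  import Data.Rational.Unnormalised as ℚᵘ
  import Data.Rational.Unnormalised.Properties as ℚᵘ

  /-cross : ∀ i j n d .{{_ : NonZero n}} .{{_ : NonZero d}} → i ℤ.* + d ≡ j ℤ.* + n → i / n ≡ j / d
  /-cross i j (suc n) (suc d) eq = ℚ.fromℚᵘ-cong {ℚᵘ.mkℚᵘ i n} {ℚᵘ.mkℚᵘ j d} (ℚᵘ.*≡* eq)

  toℚᵘ-/ : ∀ i n → toℚᵘ (i / suc n) ℚᵘ.≃ ℚᵘ.mkℚᵘ i n
  toℚᵘ-/ i n = ℚ.toℚᵘ-fromℚᵘ (ℚᵘ.mkℚᵘ i n)

  /-*-/ : ∀ i j n d .{{_ : NonZero n}} .{{_ : NonZero d}} →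
    (i / n) ℚ.* (j / d) ≡ ((i ℤ.* j) / (n * d)) {{m*n≢0 n d}}
  /-*-/ i j (suc n) (suc d) = ℚ.toℚᵘ-injective (ℚᵘ.≃-trans (ℚ.toℚᵘ-homo-* (i / suc n) (j / suc d))
    (ℚᵘ.≃-trans (ℚᵘ.*-cong (toℚᵘ-/ i n) (toℚᵘ-/ j d)) (ℚᵘ.≃-sym (toℚᵘ-/ (i ℤ.* j) _))))

  /-+-/ : ∀ i j n d .{{_ : NonZero n}} .{{_ : NonZero d}} →
    (i / n) ℚ.+ (j / d) ≡ ((i ℤ.* + d ℤ.+ j ℤ.* + n) / (n * d)) {{m*n≢0 n d}}
  /-+-/ i j (suc n) (suc d) = ℚ.toℚᵘ-injective (ℚᵘ.≃-trans (ℚ.toℚᵘ-homo-+ (i / suc n) (j / suc d))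
    (ℚᵘ.≃-trans (ℚᵘ.+-cong (toℚᵘ-/ i n) (toℚᵘ-/ j d)) (ℚᵘ.≃-sym (toℚᵘ-/ _ _))))

  fromℕ : ℕ → ℚ
  fromℕ n = + n / 1

  fromℕ-homo-* : ∀ m n → fromℕ (m * n) ≡ fromℕ m ℚ.* fromℕ n
  fromℕ-homo-* m n = sym (trans (/-*-/ (+ m) (+ n) 1 1) (cong (_/ 1) (sym (ℤ.pos-* m n))))

  fromℕ-homo-+ : ∀ m n → fromℕ (m + n) ≡ fromℕ m ℚ.+ fromℕ n
  fromℕ-homo-+ m n = sym (trans (/-+-/ (+ m) (+ n) 1 1)
    (cong (_/ 1) (trans (cong₂ ℤ._+_ (ℤ.*-identityʳ (+ m)) (ℤ.*-identityʳ (+ n))) (sym (ℤ.pos-+ m n)))))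

  fromℕ*invFact : ∀ m k → fromℕ m ℚ.* invFact k ≡ (+ m / k !) {{k !≢0}}
  fromℕ*invFact m k = trans (/-*-/ (+ m) (+ 1) 1 (k !)) (ℚ./-cong (ℤ.*-identityʳ (+ m)) (*-identityˡ (k !)))
    where
    instance
      _ = k !≢0
      _ = m*n≢0 1 (k !)

  nCk*k!*[n∸k]!≡n! : ∀ {n k} → k ≤ n → (n C k) * (k ! * (n ∸ k) !) ≡ n !
  nCk*k!*[n∸k]!≡n! {n} {k} k≤n = trans (cong (_* (k ! * (n ∸ k) !)) (nCk≡n!/k![n-k]! k≤n))
    (m/n*n≡m {{_!*_!≢0 k (n ∸ k)}} (k![n∸k]!∣n! k≤n))

  invFact*invFact : ∀ {n k} → k ≤ n → invFact k ℚ.* invFact (n ∸ k) ≡ fromℕ (n C k) ℚ.* invFact n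
  invFact*invFact {n} {k} k≤n = begin
    invFact k ℚ.* invFact (n ∸ k)  ≡⟨ /-*-/ (+ 1) (+ 1) (k !) ((n ∸ k) !) ⟩
    + 1 / (k ! * (n ∸ k) !)        ≡⟨ /-cross (+ 1) (+ (n C k)) _ _ cross ⟩
    + (n C k) / n !                ≡⟨ fromℕ*invFact (n C k) n ⟨
    fromℕ (n C k) ℚ.* invFact n    ∎
    where
    open ≡-Reasoning
    instance
      _ = k !≢0
      _ = (n ∸ k) !≢0
      _ = n !≢0
      _ = _!*_!≢0 k (n ∸ k)
    cross : + 1 ℤ.* + (n !) ≡ + (n C k) ℤ.* + (k ! * (n ∸ k) !)
    cross = trans (ℤ.*-identityˡ (+ (n !)))
      (trans (cong +_ (sym (nCk*k!*[n∸k]!≡n! k≤n))) (ℤ.pos-* (n C k) _))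

  sumTo-cong-≤ : ∀ {f g} n → (∀ {j} → j ≤ n → f j ≡ g j) → sumTo f n ≡ sumTo g n
  sumTo-cong-≤ zero f≡g = f≡g z≤n
  sumTo-cong-≤ (suc n) f≡g = cong₂ ℚ._+_ (sumTo-cong-≤ n (f≡g ∘ m≤n⇒m≤1+n)) (f≡g ≤-refl)

  sumTo-*-distribʳ : ∀ f c n → sumTo (λ j → f j ℚ.* c) n ≡ sumTo f n ℚ.* c
  sumTo-*-distribʳ f c zero = refl
  sumTo-*-distribʳ f c (suc n) = trans (cong (λ s → s ℚ.+ f (suc n) ℚ.* c) (sumTo-*-distribʳ f c n))
    (sym (ℚ.*-distribʳ-+ c (sumTo f n) (f (suc n))))

  sumTo-fromℕ : ∀ f n → sumTo (fromℕ ∘ f) n ≡ fromℕ (sumToℕ f n)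
  sumTo-fromℕ f zero = refl
  sumTo-fromℕ f (suc n) = trans (cong (λ s → s ℚ.+ fromℕ (f (suc n))) (sumTo-fromℕ f n))
    (sym (fromℕ-homo-+ (sumToℕ f n) (f (suc n))))

  twoMinusExp : Series
  twoMinusExp = constS (+ 2 / 1) ⊖ expS

  twoMinusExp-∸ : ∀ {n j} → j ≤ n → twoMinusExp (suc n ∸ j) ≡ ℚ.- invFact (suc n ∸ j)
  twoMinusExp-∸ {n} {j} j≤n rewrite +-∸-assoc 1 j≤n = ℚ.+-identityˡ (ℚ.- invFact (suc (n ∸ j)))

  module _ (b : ℕ → ℕ) where

    egf*twoMinusExp-∸ : ∀ {n j} → j ≤ n →
      egf b j ℚ.* twoMinusExp (suc n ∸ j) ≡ fromℕ ((suc n C j) * b j) ℚ.* (ℚ.- invFact (suc n))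
    egf*twoMinusExp-∸ {n} {j} j≤n = begin
      egf b j ℚ.* twoMinusExp (suc n ∸ j)
        ≡⟨ cong₂ ℚ._*_ (sym (fromℕ*invFact (b j) j)) (twoMinusExp-∸ j≤n) ⟩
      (fromℕ (b j) ℚ.* invFact j) ℚ.* (ℚ.- invFact (suc n ∸ j))
        ≡⟨ solve 3 (λ x y z → (x :* y) :* (:- z) := :- (x :* (y :* z))) refl (fromℕ (b j)) (invFact j) _ ⟩
      ℚ.- (fromℕ (b j) ℚ.* (invFact j ℚ.* invFact (suc n ∸ j)))
        ≡⟨ cong (λ q → ℚ.- (fromℕ (b j) ℚ.* q)) (invFact*invFact (m≤n⇒m≤1+n j≤n)) ⟩
      ℚ.- (fromℕ (b j) ℚ.* (fromℕ (suc n C j) ℚ.* f))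
        ≡⟨ solve 3 (λ x y z → :- (x :* (y :* z)) := (y :* x) :* (:- z)) refl (fromℕ (b j)) (fromℕ (suc n C j)) f ⟩
      (fromℕ (suc n C j) ℚ.* fromℕ (b j)) ℚ.* (ℚ.- f)
        ≡⟨ cong (λ q → q ℚ.* (ℚ.- f)) (fromℕ-homo-* (suc n C j) (b j)) ⟨
      fromℕ ((suc n C j) * b j) ℚ.* (ℚ.- f) ∎
      where
      open ≡-Reasoning
      open +-*-Solver
      f = invFact (suc n)

    sumTo-egf*twoMinusExp : ∀ n → sumTo (λ j → egf b j ℚ.* twoMinusExp (suc n ∸ j)) n
      ≡ fromℕ (sumToℕ (λ j → (suc n C j) * b j) n) ℚ.* (ℚ.- invFact (suc n))
    sumTo-egf*twoMinusExp n = trans (sumTo-cong-≤ n egf*twoMinusExp-∸)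
      (trans (sumTo-*-distribʳ (λ j → fromℕ ((suc n C j) * b j)) (ℚ.- invFact (suc n)) n)
        (cong (λ q → q ℚ.* (ℚ.- invFact (suc n))) (sumTo-fromℕ _ n)))

    egf⊛twoMinusExp≡exp : b 0 ≡ 1 → (∀ n → b (suc n) ≡ 1 + sumToℕ (λ j → (suc n C j) * b j) n) →
      ∀ k → (egf b ⊛ twoMinusExp) k ≡ expS k
    egf⊛twoMinusExp≡exp b[0]≡1 b-rec zero rewrite b[0]≡1 = refl
    egf⊛twoMinusExp≡exp b[0]≡1 b-rec (suc n) = begin
      sumTo (λ j → egf b j ℚ.* twoMinusExp (suc n ∸ j)) n ℚ.+ egf b (suc n) ℚ.* twoMinusExp (n ∸ n)
        ≡⟨ cong₂ ℚ._+_ (sumTo-egf*twoMinusExp n) top-term ⟩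
      fromℕ S ℚ.* (ℚ.- f) ℚ.+ fromℕ (b (suc n)) ℚ.* f
        ≡⟨ cong (λ m → fromℕ S ℚ.* (ℚ.- f) ℚ.+ fromℕ m ℚ.* f) (b-rec n) ⟩
      fromℕ S ℚ.* (ℚ.- f) ℚ.+ fromℕ (1 + S) ℚ.* f
        ≡⟨ cong (λ q → fromℕ S ℚ.* (ℚ.- f) ℚ.+ q ℚ.* f) (fromℕ-homo-+ 1 S) ⟩
      fromℕ S ℚ.* (ℚ.- f) ℚ.+ (1ℚ ℚ.+ fromℕ S) ℚ.* f
        ≡⟨ solve 2 (λ x z → x :* (:- z) :+ (con 1ℚ :+ x) :* z := z) refl (fromℕ S) f ⟩
      f ∎
      where
      open ≡-Reasoning
      open +-*-Solver
      f = invFact (suc n)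
      S = sumToℕ (λ j → (suc n C j) * b j) n
      top-term : egf b (suc n) ℚ.* twoMinusExp (n ∸ n) ≡ fromℕ (b (suc n)) ℚ.* f
      top-term = trans (cong (λ m → egf b (suc n) ℚ.* twoMinusExp m) (n∸n≡0 n))
        (trans (ℚ.*-identityʳ (egf b (suc n))) (sym (fromℕ*invFact (b (suc n)) (suc n))))

open PowerSeries using (egf⊛twoMinusExp≡exp)

theorem3 : (a : ℕ → ℕ) → a 1 ≡ 1 →
    (∀ n → 1 < n → a n ≡ 1 + sum (map a (properDivisors n))) →
    (p : ℕ → ℕ) → (∀ i → Prime (p i)) → Injective _≡_ _≡_ p →
    ∀ k → (egf (λ j → a (prodFirst p j)) ⊛ (constS ((+ 2) / 1) ⊖ expS)) k ≡ expS k
theorem3 a a[1]≡1 a-rec p p-prime p-injective =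
  egf⊛twoMinusExp≡exp (λ j → a (prodFirst p j)) a[1]≡1 (b-rec p p-prime p-injective)
  where open RecursiveDivisors a a[1]≡1 a-rec
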